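{- Let $n \ge 0$ and let $x, y \in D_{n+2}$, decomposed as $x = (x_0, x_1, x_2, x_3)$ and $y = (y_0, y_1, y_2, y_3)$ with all $x_i, y_i \in D_n$. Then $$\#[x, y] = \sum_{f_0 \in [x_0, y_0]} \; \sum_{f_3 \in [x_3, y_3]} \#[\,f_0 \cup x_1,\ f_3 \cap y_1\,] \cdot \#[\,f_0 \cup x_2,\ f_3 \cap y_2\,],$$ where the intervals on the right-hand side are taken in $D_n$. Equivalently, the summand equals $(M_{D_n})^2(f_0 \cup x_1, f_3 \cap y_1)\cdot (M_{D_n})^2(f_0 \cup x_2, f_3 \cap y_2)$, with $M_{D_n}$ the incidence matrix of $D_n$.
   Context: $B=\{0,1\}$ with $0 \le 1$, and $B^n$ carries the componentwise order. $D_n$ is the set of monotone Boolean functions $f: B^n \to B$ (i.e. $x \le y \Rightarrow f(x) \le f(y)$), partially ordered pointwise: $f \le g$ iff $f(x) \le g(x)$ for all $x \in B^n$. For $f,g \in D_n$, $f \cup g$ denotes the pointwise maximum (bitwise OR) and $f \cap g$ the pointwise minimum (bitwise AND). For $f, g \in D_n$, the interval $[f,g]$ is the set of $h \in D_n$ with $f \le h \le g$, and $\#[f,g]$ is its cardinality (equal to $0$ if $f \not\le g$). The incidence matrix $M_{D_n}$ has rows and columns indexed by $D_n$, with entry $1$ at $(f,g)$ if $f \le g$ and $0$ otherwise; $(M_{D_n})^2$ is its matrix square. Decomposition: a function $x \in D_{n+2}$ is identified with the tuple $(x_0,x_1,x_2,x_3)$ of functions in $D_n$ given by $x_{2a+b}(z)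 = x(a,b,z)$ for $a,b \in B$, $z \in B^n$; this identifies $D_{n+2}$ with the monotone maps $B^2 \to D_n$, i.e. tuples with $x_0 \le x_1 \le x_3$ and $x_0 \le x_2 \le x_3$, ordered componentwise. -}

module Defs where

open import Data.Bool using (Bool; true; false; _∧_; _∨_; not; T)
open import Data.Bool.Base using (_≤_)
open import Data.Nat using (ℕ; zero; suc; _+_; _*_)
open import Data.List using (List; []; _∷_; map; _++_; filterᵇ; length; cartesianProductWith)

allᵇ : {A : Set} → (A → Bool) → List A → Bool
allᵇ p []       = true
allᵇ p (a ∷ as) = p a ∧ allᵇ p as
open import Data.Vec using (Vec; []; _∷_)

_≤ᵇ_ : Bool → Bool → Bool
a ≤ᵇ b = not a ∨ b

data _≤ᵛ_ : {n : ℕ} → Vec Bool n → Vec Bool n → Set where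
  []  : [] ≤ᵛ []
  _∷_ : {n : ℕ} {a b : Bool} {u v : Vec Bool n} → a ≤ b → u ≤ᵛ v → (a ∷ u) ≤ᵛ (b ∷ v)

leVec : {n : ℕ} → Vec Bool n → Vec Bool n → Bool
leVec []       []       = true
leVec (a ∷ u) (b ∷ v) = (a ≤ᵇ b) ∧ leVec u v

BFun : ℕ → Set
BFun n = Vec Bool n → Bool

Monotone : {n : ℕ} → BFun n → Set
Monotone f = ∀ u v → u ≤ᵛ v → f u ≤ f v

allInputs : (n : ℕ) → List (Vec Bool n)
allInputs zero    = [] ∷ []
allInputs (suc n) = map (false ∷_) (allInputs n) ++ map (true ∷_) (allInputs n)

-- All Boolean functions B^n → B (each extensional function exactly once).
combine : {n : ℕ} → BFun n → BFun n → BFun (suc n)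
combine g h (false ∷ z) = g z
combine g h (true ∷ z)  = h z

allFuns : (n : ℕ) → List (BFun n)
allFuns zero    = (λ _ → false) ∷ (λ _ → true) ∷ []
allFuns (suc n) = cartesianProductWith combine (allFuns n) (allFuns n)

isMonotone : {n : ℕ} → BFun n → Bool
isMonotone {n} f =
  allᵇ (λ u → allᵇ (λ v → not (leVec u v) ∨ (f u ≤ᵇ f v)) (allInputs n)) (allInputs n)

leFun : {n : ℕ} → BFun n → BFun n → Bool
leFun {n} f g = allᵇ (λ z → f z ≤ᵇ g z) (allInputs n)

D : (n : ℕ) → List (BFun n)
D n = filterᵇ isMonotone (allFuns n)

interval : {n : ℕ} → BFun n → BFun n → List (BFun n)
interval {n} f g = filterᵇ (λ h → leFun f h ∧ leFun h g) (D n)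

#[_,_] : {n : ℕ} → BFun n → BFun n → ℕ
#[ f , g ] = length (interval f g)

_∪_ : {n : ℕ} → BFun n → BFun n → BFun n
(f ∪ g) z = f z ∨ g z

_∩_ : {n : ℕ} → BFun n → BFun n → BFun n
(f ∩ g) z = f z ∧ g z

-- Decomposition x ∈ D_{n+2} ↦ (x_0,x_1,x_2,x_3), x_{2a+b}(z) = x(a,b,z).
comp0 comp1 comp2 comp3 : {n : ℕ} → BFun (2 + n) → BFun n
comp0 x z = x (false ∷ false ∷ z)
comp1 x z = x (false ∷ true ∷ z)
comp2 x z = x (true ∷ false ∷ z)
comp3 x z = x (true ∷ true ∷ z)

-- Write h ∈ D (n+2) as its four quarters h₀, h₁, h₂, h₃ ∈ D n. Monotonicity of h is monotonicity
-- of each quarter together with h₀ ≤ h₁ ≤ h₃ and h₀ ≤ h₂ ≤ h₃, so h ∈ [x, y] says exactly that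
-- h₀ ∈ [x₀, y₀], h₃ ∈ [x₃, y₃], h₁ ∈ [h₀ ∪ x₁, h₃ ∩ y₁] and h₂ ∈ [h₀ ∪ x₂, h₃ ∩ y₂]. For fixed
-- h₀ and h₃ the conditions on h₁ and h₂ are independent, so writing #[x, y] as a sum of
-- indicators over all Boolean functions, the inner double sum factors into a product of two
-- interval sizes.

module Submission where

open import Defs
open import Data.Nat using (ℕ; _+_; _*_)
open import Data.Nat using (suc)
open import Data.List using (map)
open import Data.Nat.ListAction using (sum)
open import Relation.Binary.PropositionalEquality using (_≡_)

open import Algebra.Bundles using (CommutativeMonoid)
open import Data.Bool using (Bool; true; false; _∧_; _∨_; not; if_then_else_)
open import Data.Bool.Properties using (∧-comm; ∧-assoc; ∧-identityʳ; ∧-idem; ∧-commutativeMonoid; ⇔→≡)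
open import Data.List using (List; []; _∷_; _++_; filterᵇ; length; cartesianProductWith)
open import Data.List.Membership.Propositional using (_∈_)
open import Data.List.Membership.Propositional.Properties using (∈-++⁺ˡ; ∈-++⁺ʳ; ∈-map⁺)
open import Data.List.Properties using (map-++; map-∘)
open import Data.List.Relation.Unary.Any using (here; there)
open import Data.Nat.ListAction.Properties using (sum-++)
open import Data.Nat.Properties using (+-identityʳ; *-identityʳ; *-zeroʳ; *-assoc; *-distribˡ-+; *-distribʳ-+)
open import Data.Nat.Tactic.RingSolver using (solve-∀)
open import Data.Vec using (Vec; []; _∷_)
open import Function using (_∘_)
open import Function.Bundles using (mk⇔)
open import Relation.Binary.PropositionalEquality using (refl; sym; trans; cong; cong₂; module ≡-Reasoning)

open import Algebra.Properties.CommutativeSemigroup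
  (CommutativeMonoid.commutativeSemigroup ∧-commutativeMonoid) using (interchange)

private
  variable
    A B C : Set
    n : ℕ

allᵇ-++ : (p : A → Bool) (xs ys : List A) → allᵇ p (xs ++ ys) ≡ allᵇ p xs ∧ allᵇ p ys
allᵇ-++ p []       ys = refl
allᵇ-++ p (x ∷ xs) ys = trans (cong (p x ∧_) (allᵇ-++ p xs ys)) (sym (∧-assoc (p x) _ _))

allᵇ-map : (p : B → Bool) (f : A → B) (xs : List A) → allᵇ p (map f xs) ≡ allᵇ (p ∘ f) xs
allᵇ-map p f []       = refl
allᵇ-map p f (x ∷ xs) = cong (p (f x) ∧_) (allᵇ-map p f xs)

allᵇ-cong : {p q : A → Bool} → (∀ a → p a ≡ q a) → ∀ xs → allᵇ p xs ≡ allᵇ q xs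
allᵇ-cong e []       = refl
allᵇ-cong e (x ∷ xs) = cong₂ _∧_ (e x) (allᵇ-cong e xs)

allᵇ-∧ : (p q : A → Bool) (xs : List A) → allᵇ (λ a → p a ∧ q a) xs ≡ allᵇ p xs ∧ allᵇ q xs
allᵇ-∧ p q []       = refl
allᵇ-∧ p q (x ∷ xs) = trans (cong ((p x ∧ q x) ∧_) (allᵇ-∧ p q xs)) (interchange (p x) (q x) _ _)

allᵇ-true : (xs : List A) → allᵇ (λ _ → true) xs ≡ true
allᵇ-true []       = refl
allᵇ-true (x ∷ xs) = allᵇ-true xs

allᵇ-intro : (p : A → Bool) → (∀ a → p a ≡ true) → ∀ xs → allᵇ p xs ≡ true
allᵇ-intro p h []       = refl
allᵇ-intro p h (x ∷ xs) = trans (cong (_∧ allᵇ p xs) (h x)) (allᵇ-intro p h xs)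

allᵇ-elim : (p : A → Bool) {xs : List A} {a : A} → allᵇ p xs ≡ true → a ∈ xs → p a ≡ true
allᵇ-elim p {x ∷ _} e (here refl) with p x
... | true = refl
allᵇ-elim p {x ∷ _} e (there a∈xs) with p x
... | true = allᵇ-elim p e a∈xs

∈-allInputs : (u : Vec Bool n) → u ∈ allInputs n
∈-allInputs []          = here refl
∈-allInputs (false ∷ u) = ∈-++⁺ˡ (∈-map⁺ (false ∷_) (∈-allInputs u))
∈-allInputs {suc n} (true ∷ u) =
  ∈-++⁺ʳ (map (false ∷_) (allInputs n)) (∈-map⁺ (true ∷_) (∈-allInputs u))

allᵇ-allInputs-suc : (p : Vec Bool (suc n) → Bool) →
  allᵇ p (allInputs (suc n)) ≡
    allᵇ (λ z → p (false ∷ z)) (allInputs n) ∧ allᵇ (λ z → p (true ∷ z)) (allInputs n)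
allᵇ-allInputs-suc {n} p =
  trans (allᵇ-++ p (map (false ∷_) (allInputs n)) _)
        (cong₂ _∧_ (allᵇ-map p (false ∷_) (allInputs n)) (allᵇ-map p (true ∷_) (allInputs n)))

leVec-refl : (u : Vec Bool n) → leVec u u ≡ true
leVec-refl []          = refl
leVec-refl (false ∷ u) = leVec-refl u
leVec-refl (true ∷ u)  = leVec-refl u

≤ᵇ-trans : ∀ a b c → a ≤ᵇ b ≡ true → b ≤ᵇ c ≡ true → a ≤ᵇ c ≡ true
≤ᵇ-trans false b    c    _ _ = refl
≤ᵇ-trans true  true true _ _ = refl

_↾_ : BFun (suc n) → Bool → BFun n
(f ↾ b) z = f (b ∷ z)

leFun-split : (f g : BFun (suc n)) →
  leFun f g ≡ leFun (f ↾ false) (g ↾ false) ∧ leFun (f ↾ true) (g ↾ true)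
leFun-split f g = allᵇ-allInputs-suc (λ z → f z ≤ᵇ g z)

leFun-split₂ : (f g : BFun (2 + n)) →
  leFun f g ≡
    (leFun (comp0 f) (comp0 g) ∧ leFun (comp1 f) (comp1 g)) ∧
    (leFun (comp2 f) (comp2 g) ∧ leFun (comp3 f) (comp3 g))
leFun-split₂ f g =
  trans (leFun-split f g) (cong₂ _∧_ (leFun-split (f ↾ false) (g ↾ false)) (leFun-split (f ↾ true) (g ↾ true)))

leFun-∪ˡ : (f g h : BFun n) → leFun (f ∪ g) h ≡ leFun f h ∧ leFun g h
leFun-∪ˡ {n} f g h =
  trans (allᵇ-cong (λ z → pointwise (f z) (g z) (h z)) (allInputs n)) (allᵇ-∧ _ _ (allInputs n))
  where
  pointwise : ∀ p q r → (p ∨ q) ≤ᵇ r ≡ (p ≤ᵇ r) ∧ (q ≤ᵇ r)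
  pointwise false q     r = refl
  pointwise true  false r = sym (∧-identityʳ r)
  pointwise true  true  r = sym (∧-idem r)

leFun-∩ʳ : (h f g : BFun n) → leFun h (f ∩ g) ≡ leFun h f ∧ leFun h g
leFun-∩ʳ {n} h f g =
  trans (allᵇ-cong (λ z → pointwise (h z) (f z) (g z)) (allInputs n)) (allᵇ-∧ _ _ (allInputs n))
  where
  pointwise : ∀ r p q → r ≤ᵇ (p ∧ q) ≡ (r ≤ᵇ p) ∧ (r ≤ᵇ q)
  pointwise false p q = refl
  pointwise true  p q = refl

-- monotoneBetween f f unfolds to isMonotone f.
monotoneBetween : BFun n → BFun n → Bool
monotoneBetween {n} g h =
  allᵇ (λ u → allᵇ (λ v → not (leVec u v) ∨ (g u ≤ᵇ h v)) (allInputs n)) (allInputs n)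

-- The block u = true ∷ _, v = false ∷ _ is vacuous: leVec computes to false there.
isMonotone-split-between : (f : BFun (suc n)) →
  isMonotone f ≡
    (isMonotone (f ↾ false) ∧ monotoneBetween (f ↾ false) (f ↾ true)) ∧ isMonotone (f ↾ true)
isMonotone-split-between {n} f = begin
    isMonotone f
  ≡⟨ allᵇ-allInputs-suc (λ u → allᵇ (step u) (allInputs (suc n))) ⟩
    allᵇ (λ u → allᵇ (step (false ∷ u)) (allInputs (suc n))) I ∧
    allᵇ (λ u → allᵇ (step (true ∷ u)) (allInputs (suc n))) I
  ≡⟨ cong₂ _∧_ (allᵇ-cong (λ u → allᵇ-allInputs-suc (step (false ∷ u))) I)
               (allᵇ-cong (λ u → allᵇ-allInputs-suc (step (true ∷ u))) I) ⟩
    allᵇ (λ u → allᵇ (λ v → step₀ u v (f ↾ false)) I ∧ allᵇ (λ v → step₀ u v (f ↾ true)) I) I ∧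
    allᵇ (λ u → allᵇ (λ _ → true) I ∧ allᵇ (λ v → step₁ u v) I) I
  ≡⟨ cong₂ _∧_ (allᵇ-∧ _ _ I) (allᵇ-cong (λ u → cong (_∧ allᵇ (step₁ u) I) (allᵇ-true I)) I) ⟩
    (isMonotone (f ↾ false) ∧ monotoneBetween (f ↾ false) (f ↾ true)) ∧ isMonotone (f ↾ true)
  ∎
  where
  open ≡-Reasoning
  I : List (Vec Bool n)
  I = allInputs n
  step : Vec Bool (suc n) → Vec Bool (suc n) → Bool
  step u v = not (leVec u v) ∨ (f u ≤ᵇ f v)
  step₀ : Vec Bool n → Vec Bool n → BFun n → Bool
  step₀ u v g = not (leVec u v) ∨ ((f ↾ false) u ≤ᵇ g v)
  step₁ : Vec Bool n → Vec Bool n → Bool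
  step₁ u v = not (leVec u v) ∨ ((f ↾ true) u ≤ᵇ (f ↾ true) v)

monotoneBetween≡leFun : (g h : BFun n) → isMonotone g ≡ true →
  monotoneBetween g h ≡ leFun g h
monotoneBetween≡leFun {n} g h g-mono = ⇔→≡ (mk⇔ diagonal spread)
  where
  I : List (Vec Bool n)
  I = allInputs n
  diagonal : monotoneBetween g h ≡ true → leFun g h ≡ true
  diagonal e = allᵇ-intro _ at I
    where
    at : ∀ z → g z ≤ᵇ h z ≡ true
    at z = trans (cong (λ b → not b ∨ (g z ≤ᵇ h z)) (sym (leVec-refl z)))
                 (allᵇ-elim _ (allᵇ-elim _ e (∈-allInputs z)) (∈-allInputs z))
  spread : leFun g h ≡ true → monotoneBetween g h ≡ true
  spread e = allᵇ-intro _ (λ u → allᵇ-intro _ (at u) I) I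
    where
    at : ∀ u v → not (leVec u v) ∨ (g u ≤ᵇ h v) ≡ true
    at u v with leVec u v in u≤v
    ... | false = refl
    ... | true  = ≤ᵇ-trans (g u) (g v) (h v) g-mono-uv (allᵇ-elim _ e (∈-allInputs v))
      where
      g-mono-uv : g u ≤ᵇ g v ≡ true
      g-mono-uv = trans (cong (λ b → not b ∨ (g u ≤ᵇ g v)) (sym u≤v))
                        (allᵇ-elim _ (allᵇ-elim _ g-mono (∈-allInputs u)) (∈-allInputs v))

isMonotone-split : (f : BFun (suc n)) →
  isMonotone f ≡
    (isMonotone (f ↾ false) ∧ isMonotone (f ↾ true)) ∧ leFun (f ↾ false) (f ↾ true)
isMonotone-split f = trans (isMonotone-split-between f) (reassociate _ refl)
  where
  reassociate : ∀ b → isMonotone (f ↾ false) ≡ b →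
    (b ∧ monotoneBetween (f ↾ false) (f ↾ true)) ∧ isMonotone (f ↾ true) ≡
      (b ∧ isMonotone (f ↾ true)) ∧ leFun (f ↾ false) (f ↾ true)
  reassociate false _       = refl
  reassociate true  f₀-mono =
    trans (cong (_∧ isMonotone (f ↾ true)) (monotoneBetween≡leFun (f ↾ false) (f ↾ true) f₀-mono))
          (∧-comm (leFun (f ↾ false) (f ↾ true)) (isMonotone (f ↾ true)))

isMonotone-square : (a b c d : BFun n) →
  isMonotone (combine (combine a b) (combine c d)) ≡
    (((isMonotone a ∧ isMonotone b) ∧ leFun a b) ∧ ((isMonotone c ∧ isMonotone d) ∧ leFun c d)) ∧
    (leFun a c ∧ leFun b d)
isMonotone-square a b c d =
  trans (isMonotone-split (combine (combine a b) (combine c d)))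
        (cong₂ _∧_ (cong₂ _∧_ (isMonotone-split (combine a b)) (isMonotone-split (combine c d)))
                   (leFun-split (combine a b) (combine c d)))

_∈ᵇ[_,_] : BFun n → BFun n → BFun n → Bool
h ∈ᵇ[ f , g ] = isMonotone h ∧ (leFun f h ∧ leFun h g)

∈ᵇ-square : (x y : BFun (2 + n)) (a b c d : BFun n) →
  combine (combine a b) (combine c d) ∈ᵇ[ x , y ] ≡
    (a ∈ᵇ[ comp0 x , comp0 y ] ∧ d ∈ᵇ[ comp3 x , comp3 y ]) ∧
    (b ∈ᵇ[ a ∪ comp1 x , d ∩ comp1 y ] ∧ c ∈ᵇ[ a ∪ comp2 x , d ∩ comp2 y ])
∈ᵇ-square x y a b c d =
  trans (cong₂ _∧_ (isMonotone-square a b c d) (cong₂ _∧_ (leFun-split₂ x h) (leFun-split₂ h y)))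
  (trans (solve 16 (λ Ma Mb Mc Md Lab Lcd Lac Lbd X₀ X₁ X₂ X₃ Y₀ Y₁ Y₂ Y₃ →
                      ((((Ma ⊕ Mb) ⊕ Lab) ⊕ ((Mc ⊕ Md) ⊕ Lcd)) ⊕ (Lac ⊕ Lbd)) ⊕
                      (((X₀ ⊕ X₁) ⊕ (X₂ ⊕ X₃)) ⊕ ((Y₀ ⊕ Y₁) ⊕ (Y₂ ⊕ Y₃)))
                    ⊜ ((Ma ⊕ (X₀ ⊕ Y₀)) ⊕ (Md ⊕ (X₃ ⊕ Y₃))) ⊕
                      ((Mb ⊕ ((Lab ⊕ X₁) ⊕ (Lbd ⊕ Y₁))) ⊕ (Mc ⊕ ((Lac ⊕ X₂) ⊕ (Lcd ⊕ Y₂)))))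
                 refl
                 (isMonotone a) (isMonotone b) (isMonotone c) (isMonotone d)
                 (leFun a b) (leFun c d) (leFun a c) (leFun b d)
                 (leFun (comp0 x) a) (leFun (comp1 x) b) (leFun (comp2 x) c) (leFun (comp3 x) d)
                 (leFun a (comp0 y)) (leFun b (comp1 y)) (leFun c (comp2 y)) (leFun d (comp3 y)))
  (sym (cong (corners ∧_) (cong₂ _∧_ (cong (isMonotone b ∧_) (bounds (comp1 x) (comp1 y) b))
                                  (cong (isMonotone c ∧_) (bounds (comp2 x) (comp2 y) c))))))
  where
  open import Algebra.Solver.CommutativeMonoid ∧-commutativeMonoid using (solve; _⊕_; _⊜_)
  h : BFun (2 + _)
  h = combine (combine a b) (combine c d)
  corners : Bool
  corners = a ∈ᵇ[ comp0 x , comp0 y ] ∧ d ∈ᵇ[ comp3 x , comp3 y ]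
  bounds : ∀ xᵢ yᵢ e → leFun (a ∪ xᵢ) e ∧ leFun e (d ∩ yᵢ) ≡ (leFun a e ∧ leFun xᵢ e) ∧ (leFun e d ∧ leFun e yᵢ)
  bounds xᵢ yᵢ e = cong₂ _∧_ (leFun-∪ˡ a xᵢ e) (leFun-∩ʳ e d yᵢ)

∑ : List A → (A → ℕ) → ℕ
∑ xs F = sum (map F xs)

infix 5 ∑
syntax ∑ xs (λ a → F) = ∑[ a ∈ xs ] F

∑-cong : (xs : List A) {F G : A → ℕ} → (∀ a → F a ≡ G a) → ∑ xs F ≡ ∑ xs G
∑-cong []       e = refl
∑-cong (x ∷ xs) e = cong₂ _+_ (e x) (∑-cong xs e)

∑-++ : (xs ys : List A) (F : A → ℕ) → ∑ (xs ++ ys) F ≡ ∑ xs F + ∑ ys F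
∑-++ xs ys F = trans (cong sum (map-++ F xs ys)) (sum-++ (map F xs) (map F ys))

∑-map : (g : A → B) (xs : List A) (F : B → ℕ) → ∑ (map g xs) F ≡ ∑ xs (F ∘ g)
∑-map g xs F = cong sum (sym (map-∘ xs))

∑-cartesianProductWith : (f : A → B → C) (xs : List A) (ys : List B) (F : C → ℕ) →
  ∑ (cartesianProductWith f xs ys) F ≡ ∑[ a ∈ xs ] ∑[ b ∈ ys ] F (f a b)
∑-cartesianProductWith f []       ys F = refl
∑-cartesianProductWith f (x ∷ xs) ys F =
  trans (∑-++ (map (f x) ys) _ F) (cong₂ _+_ (∑-map (f x) ys F) (∑-cartesianProductWith f xs ys F))

∑-zero : (xs : List A) → ∑[ _ ∈ xs ] 0 ≡ 0
∑-zero []       = refl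
∑-zero (x ∷ xs) = ∑-zero xs

∑-+ : (xs : List A) (F G : A → ℕ) → ∑[ a ∈ xs ] (F a + G a) ≡ ∑ xs F + ∑ xs G
∑-+ []       F G = refl
∑-+ (x ∷ xs) F G = trans (cong (F x + G x +_) (∑-+ xs F G)) (interchange⁺ (F x) (G x) (∑ xs F) (∑ xs G))
  where
  interchange⁺ : ∀ a b c d → (a + b) + (c + d) ≡ (a + c) + (b + d)
  interchange⁺ = solve-∀

∑-comm : (xs : List A) (ys : List B) (F : A → B → ℕ) →
  ∑[ a ∈ xs ] ∑[ b ∈ ys ] F a b ≡ ∑[ b ∈ ys ] ∑[ a ∈ xs ] F a b
∑-comm []       ys F = sym (∑-zero ys)
∑-comm (x ∷ xs) ys F = trans (cong (∑ ys (F x) +_) (∑-comm xs ys F)) (sym (∑-+ ys (F x) _))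

*-∑ : (k : ℕ) (xs : List A) (F : A → ℕ) → k * ∑ xs F ≡ ∑[ a ∈ xs ] k * F a
*-∑ k []       F = *-zeroʳ k
*-∑ k (x ∷ xs) F = trans (*-distribˡ-+ k (F x) _) (cong (k * F x +_) (*-∑ k xs F))

∑-* : (xs : List A) (F : A → ℕ) (k : ℕ) → ∑ xs F * k ≡ ∑[ a ∈ xs ] F a * k
∑-* []       F k = refl
∑-* (x ∷ xs) F k = trans (*-distribʳ-+ k (F x) _) (cong (F x * k +_) (∑-* xs F k))

∑-*-∑ : (xs : List A) (ys : List B) (F : A → ℕ) (G : B → ℕ) →
  ∑ xs F * ∑ ys G ≡ ∑[ a ∈ xs ] ∑[ b ∈ ys ] F a * G b
∑-*-∑ xs ys F G = trans (∑-* xs F (∑ ys G)) (∑-cong xs (λ a → *-∑ (F a) ys G))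

length≡∑1 : (xs : List A) → length xs ≡ ∑[ _ ∈ xs ] 1
length≡∑1 []       = refl
length≡∑1 (x ∷ xs) = cong (1 +_) (length≡∑1 xs)

𝟙 : Bool → ℕ
𝟙 b = if b then 1 else 0

𝟙-∧ : ∀ a b → 𝟙 (a ∧ b) ≡ 𝟙 a * 𝟙 b
𝟙-∧ false b = refl
𝟙-∧ true  b = sym (+-identityʳ (𝟙 b))

∑-filterᵇ : (p : A → Bool) (xs : List A) (F : A → ℕ) → ∑ (filterᵇ p xs) F ≡ ∑[ a ∈ xs ] 𝟙 (p a) * F a
∑-filterᵇ p []       F = refl
∑-filterᵇ p (x ∷ xs) F with p x
... | false = ∑-filterᵇ p xs F
... | true  = cong₂ _+_ (sym (+-identityʳ (F x))) (∑-filterᵇ p xs F)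

∑-interval : (f g : BFun n) (G : BFun n → ℕ) →
  ∑ (interval f g) G ≡ ∑[ h ∈ allFuns n ] 𝟙 (h ∈ᵇ[ f , g ]) * G h
∑-interval {n} f g G = begin
    ∑ (filterᵇ (λ h → leFun f h ∧ leFun h g) (D n)) G
  ≡⟨ ∑-filterᵇ _ (D n) G ⟩
    ∑[ h ∈ D n ] 𝟙 (leFun f h ∧ leFun h g) * G h
  ≡⟨ ∑-filterᵇ isMonotone (allFuns n) _ ⟩
    ∑[ h ∈ allFuns n ] 𝟙 (isMonotone h) * (𝟙 (leFun f h ∧ leFun h g) * G h)
  ≡⟨ ∑-cong (allFuns n) (λ h → trans (sym (*-assoc (𝟙 (isMonotone h)) _ (G h)))
                                     (cong (_* G h) (sym (𝟙-∧ (isMonotone h) _)))) ⟩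
    ∑[ h ∈ allFuns n ] 𝟙 (h ∈ᵇ[ f , g ]) * G h
  ∎
  where open ≡-Reasoning

#-interval : (f g : BFun n) → #[ f , g ] ≡ ∑[ h ∈ allFuns n ] 𝟙 (h ∈ᵇ[ f , g ])
#-interval {n} f g =
  trans (length≡∑1 (interval f g))
        (trans (∑-interval f g (λ _ → 1)) (∑-cong (allFuns n) (λ h → *-identityʳ (𝟙 (h ∈ᵇ[ f , g ])))))

∑-allFuns-square : (F : BFun (2 + n) → ℕ) →
  ∑ (allFuns (2 + n)) F ≡
    ∑[ a ∈ allFuns n ] ∑[ d ∈ allFuns n ] ∑[ b ∈ allFuns n ] ∑[ c ∈ allFuns n ]
      F (combine (combine a b) (combine c d))
∑-allFuns-square {n} F = begin
    ∑ (allFuns (2 + n)) F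
  ≡⟨ ∑-cartesianProductWith combine (allFuns (suc n)) (allFuns (suc n)) F ⟩
    ∑[ g ∈ allFuns (suc n) ] ∑[ h ∈ allFuns (suc n) ] F (combine g h)
  ≡⟨ ∑-cartesianProductWith combine Fns Fns _ ⟩
    ∑[ a ∈ Fns ] ∑[ b ∈ Fns ] ∑[ h ∈ allFuns (suc n) ] F (combine (combine a b) h)
  ≡⟨ ∑-cong Fns (λ a → ∑-cong Fns (λ b → ∑-cartesianProductWith combine Fns Fns _)) ⟩
    ∑[ a ∈ Fns ] ∑[ b ∈ Fns ] ∑[ c ∈ Fns ] ∑[ d ∈ Fns ] F (combine (combine a b) (combine c d))
  ≡⟨ ∑-cong Fns (λ a → ∑-cong Fns (λ b → ∑-comm Fns Fns _)) ⟩
    ∑[ a ∈ Fns ] ∑[ b ∈ Fns ] ∑[ d ∈ Fns ] ∑[ c ∈ Fns ] F (combine (combine a b) (combine c d))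
  ≡⟨ ∑-cong Fns (λ a → ∑-comm Fns Fns _) ⟩
    ∑[ a ∈ Fns ] ∑[ d ∈ Fns ] ∑[ b ∈ Fns ] ∑[ c ∈ Fns ] F (combine (combine a b) (combine c d))
  ∎
  where
  open ≡-Reasoning
  Fns : List (BFun n)
  Fns = allFuns n

∑-interval² : (f g f′ g′ : BFun n) (G : BFun n → BFun n → ℕ) →
  ∑[ a ∈ interval f g ] ∑[ d ∈ interval f′ g′ ] G a d ≡
    ∑[ a ∈ allFuns n ] ∑[ d ∈ allFuns n ] 𝟙 (a ∈ᵇ[ f , g ] ∧ d ∈ᵇ[ f′ , g′ ]) * G a d
∑-interval² {n} f g f′ g′ G =
  trans (∑-interval f g _) (∑-cong (allFuns n) λ a →
    trans (cong (𝟙 (a ∈ᵇ[ f , g ]) *_) (∑-interval f′ g′ (G a)))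
    (trans (*-∑ (𝟙 (a ∈ᵇ[ f , g ])) (allFuns n) _) (∑-cong (allFuns n) λ d →
      trans (sym (*-assoc (𝟙 (a ∈ᵇ[ f , g ])) _ (G a d)))
            (cong (_* G a d) (sym (𝟙-∧ (a ∈ᵇ[ f , g ]) (d ∈ᵇ[ f′ , g′ ])))))))

#-interval-* : (f g f′ g′ : BFun n) →
  #[ f , g ] * #[ f′ , g′ ] ≡ ∑[ b ∈ allFuns n ] ∑[ c ∈ allFuns n ] 𝟙 (b ∈ᵇ[ f , g ] ∧ c ∈ᵇ[ f′ , g′ ])
#-interval-* {n} f g f′ g′ =
  trans (cong₂ _*_ (#-interval f g) (#-interval f′ g′))
  (trans (∑-*-∑ (allFuns n) (allFuns n) _ _)
         (∑-cong (allFuns n) λ b → ∑-cong (allFuns n) λ c → sym (𝟙-∧ (b ∈ᵇ[ f , g ]) (c ∈ᵇ[ f′ , g′ ]))))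

∑∑-𝟙-∧ˡ : (p : Bool) (xs : List A) (ys : List B) (q : A → B → Bool) →
  ∑[ a ∈ xs ] ∑[ b ∈ ys ] 𝟙 (p ∧ q a b) ≡ 𝟙 p * (∑[ a ∈ xs ] ∑[ b ∈ ys ] 𝟙 (q a b))
∑∑-𝟙-∧ˡ p xs ys q = sym (trans (*-∑ (𝟙 p) xs _) (∑-cong xs λ a →
  trans (*-∑ (𝟙 p) ys _) (∑-cong ys λ b → sym (𝟙-∧ p (q a b)))))

mainTheorem2 : (n : ℕ) (x y : BFun (2 + n)) → Monotone x → Monotone y →
    #[ x , y ] ≡
      sum (map (λ f₀ →
        sum (map (λ f₃ →
          #[ f₀ ∪ comp1 x , f₃ ∩ comp1 y ] * #[ f₀ ∪ comp2 x , f₃ ∩ comp2 y ])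
          (interval (comp3 x) (comp3 y))))
        (interval (comp0 x) (comp0 y)))
mainTheorem2 n x y _ _ = begin
    #[ x , y ]
  ≡⟨ trans (#-interval x y) (∑-allFuns-square (λ h → 𝟙 (h ∈ᵇ[ x , y ]))) ⟩
    ∑[ a ∈ Fns ] ∑[ d ∈ Fns ] ∑[ b ∈ Fns ] ∑[ c ∈ Fns ] 𝟙 (combine (combine a b) (combine c d) ∈ᵇ[ x , y ])
  ≡⟨ (∑-cong Fns λ a → ∑-cong Fns λ d → ∑-cong Fns λ b → ∑-cong Fns λ c → cong 𝟙 (∈ᵇ-square x y a b c d)) ⟩
    ∑[ a ∈ Fns ] ∑[ d ∈ Fns ] ∑[ b ∈ Fns ] ∑[ c ∈ Fns ] 𝟙 (corners a d ∧ (side₁ a d b ∧ side₂ a d c))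
  ≡⟨ (∑-cong Fns λ a → ∑-cong Fns λ d → ∑∑-𝟙-∧ˡ (corners a d) Fns Fns _) ⟩
    ∑[ a ∈ Fns ] ∑[ d ∈ Fns ] 𝟙 (corners a d) * (∑[ b ∈ Fns ] ∑[ c ∈ Fns ] 𝟙 (side₁ a d b ∧ side₂ a d c))
  ≡⟨ (∑-cong Fns λ a → ∑-cong Fns λ d → cong (𝟙 (corners a d) *_) (sym (#-interval-* (a ∪ comp1 x) (d ∩ comp1 y) (a ∪ comp2 x) (d ∩ comp2 y)))) ⟩
    ∑[ a ∈ Fns ] ∑[ d ∈ Fns ] 𝟙 (corners a d) * (#[ a ∪ comp1 x , d ∩ comp1 y ] * #[ a ∪ comp2 x , d ∩ comp2 y ])
  ≡⟨ sym (∑-interval² (comp0 x) (comp0 y) (comp3 x) (comp3 y) _) ⟩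
    ∑[ a ∈ interval (comp0 x) (comp0 y) ] ∑[ d ∈ interval (comp3 x) (comp3 y) ]
      #[ a ∪ comp1 x , d ∩ comp1 y ] * #[ a ∪ comp2 x , d ∩ comp2 y ]
  ∎
  where
  open ≡-Reasoning
  Fns : List (BFun n)
  Fns = allFuns n
  corners : BFun n → BFun n → Bool
  corners a d = a ∈ᵇ[ comp0 x , comp0 y ] ∧ d ∈ᵇ[ comp3 x , comp3 y ]
  side₁ side₂ : BFun n → BFun n → BFun n → Bool
  side₁ a d b = b ∈ᵇ[ a ∪ comp1 x , d ∩ comp1 y ]
  side₂ a d c = c ∈ᵇ[ a ∪ comp2 x , d ∩ comp2 y ]
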